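{- For a partition $\lambda$ with at most $n$ parts, \[ g_\lambda(x_1,\dots,x_n;\boldsymbol\alpha,\boldsymbol\beta)=\det\Big(h_{\lambda_i-i+j}\big[X_n-A_{\lambda_i-1}+B_{i-1}-B_{j-1}\big]\Big)_{i,j=1}^n. \]
   Context: $A_k=\alpha_1+\dots+\alpha_k$, $B_k=\beta_1+\dots+\beta_k$ for $k\ge1$, $A_k=B_k=0$ for $k\le0$; $X_n=x_1+\dots+x_n$. For a formal $\mathbb Z$-linear combination $Z=\sum_uc_uu$ of variables/parameters, $\sum_{m\ge0}h_m[Z]t^m=\prod_u(1-ut)^{ -c_u}$, $h_m[Z]=0$ for $m<0$. $g_\lambda(x_1,\dots,x_n;\boldsymbol\alpha,\boldsymbol\beta)=\det(h_{\lambda_i+n-i}[x_j-A_{\lambda_i-1}+B_{i-1}])_{i,j=1}^n/\prod_{1\le i<j\le n}(x_i-x_j)$. -}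

module Defs where

open import Algebra.Bundles using (CommutativeRing)
open import Data.Nat as ℕ using (ℕ; zero; suc; _∸_)
open import Data.Integer as ℤ using (ℤ; +_; -[1+_])
open import Data.Fin using (Fin; zero; suc; toℕ; punchIn; _≤_)
open import Data.Bool using (Bool; true; false)
open import Data.Product using (_×_; _,_)
open import Data.List using (List; []; _∷_; _++_; map)
open import Function using (_∘_)

IsPartition : ∀ {n} → (Fin n → ℕ) → Set
IsPartition {n} lam = ∀ (i j : Fin n) → i ≤ j → lam j ℕ.≤ lam i

module _ {c ℓ} (R : CommutativeRing c ℓ) where
  open CommutativeRing R using (_+_; _*_; _-_; 0#; 1#) renaming (Carrier to A)

  sumFin : ∀ {n} → (Fin n → A) → A
  sumFin {zero} f = 0#
  sumFin {suc n} f = f zero + sumFin (f ∘ suc)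

  prodFin : ∀ {n} → (Fin n → A) → A
  prodFin {zero} f = 1#
  prodFin {suc n} f = f zero * prodFin (f ∘ suc)

  altSum : ∀ {n} → (Fin n → A) → A
  altSum {zero} f = 0#
  altSum {suc n} f = f zero - altSum (f ∘ suc)

  det : ∀ n → (Fin n → Fin n → A) → A
  det zero M = 1#
  det (suc n) M = altSum (λ j → M zero j * det n (λ i k → M (suc i) (punchIn j k)))

  vandermonde : ∀ n → (Fin n → A) → A
  vandermonde zero x = 1#
  vandermonde (suc n) x = prodFin (λ j → x zero - x (suc j)) * vandermonde n (x ∘ suc)

  -- A formal ℤ-linear combination of ring elements, as a list of
  -- signed unit terms: (true , u) stands for +u, (false , u) for -u.
  Combo : Set c
  Combo = List (Bool × A)

  -- h_m[Z], defined by  Σ_m h_m[Z] t^m = ∏_u (1 - u t)^{-c_u}.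
  -- Recurrences: h_m[u + Z] = h_m[Z] + u h_{m-1}[u + Z],
  --              h_m[Z - u] = h_m[Z] - u h_{m-1}[Z].
  hN : Combo → ℕ → A
  hN [] zero = 1#
  hN [] (suc m) = 0#
  hN ((true , u) ∷ Z) zero = hN Z zero
  hN ((true , u) ∷ Z) (suc m) = hN Z (suc m) + u * hN ((true , u) ∷ Z) m
  hN ((false , u) ∷ Z) zero = hN Z zero
  hN ((false , u) ∷ Z) (suc m) = hN Z (suc m) - u * hN Z m

  h : ℤ → Combo → A
  h (+ m) Z = hN Z m
  h -[1+ m ] Z = 0#

  -- the list u_1, …, u_k of a sequence u : ℕ → A indexed from 1
  upto : (ℕ → A) → ℕ → List A
  upto u zero = []
  upto u (suc k) = u (suc k) ∷ upto u k

  plus minus : List A → Combo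
  plus = map (λ u → (true , u))
  minus = map (λ u → (false , u))

  -- formal sums A_k = α_1+…+α_k, B_k, X_n  (A_k = 0 for k ≤ 0;
  -- A_{λ_i - 1} is written with truncated subtraction λ_i ∸ 1, which
  -- agrees since A_{-1} = A_0 = 0)
  sumA : (ℕ → A) → ℕ → Combo
  sumA α k = plus (upto α k)

  negA : (ℕ → A) → ℕ → Combo
  negA α k = minus (upto α k)

  Xn : ∀ {n} → (Fin n → A) → Combo
  Xn {zero} x = []
  Xn {suc n} x = (true , x zero) ∷ Xn (x ∘ suc)

  idx : ∀ {n} → Fin n → ℕ
  idx i = suc (toℕ i)

  -- numerator of g_λ:
  -- det( h_{λ_i+n-i}[x_j - A_{λ_i-1} + B_{i-1}] )_{i,j=1}^n
  gNumerator : ∀ n → (Fin n → ℕ) → (Fin n → A) → (ℕ → A) → (ℕ → A) → A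
  gNumerator n lam x α β =
    det n (λ i j → h (+ (lam i ℕ.+ (n ∸ idx i)))
                     ((true , x j) ∷ (negA α (lam i ∸ 1) ++ sumA β (idx i ∸ 1))))

  -- right-hand side of Theorem 5.1:
  -- det( h_{λ_i-i+j}[X_n - A_{λ_i-1} + B_{i-1} - B_{j-1}] )_{i,j=1}^n
  rhsDet : ∀ n → (Fin n → ℕ) → (Fin n → A) → (ℕ → A) → (ℕ → A) → A
  rhsDet n lam x α β =
    det n (λ i j → h ((+ lam i ℤ.- + idx i) ℤ.+ + idx j)
                     (Xn x ++ (negA α (lam i ∸ 1) ++ (sumA β (idx i ∸ 1) ++ negA β (idx j ∸ 1)))))

-- Every row of both determinants has the form h_{λ_i - i + d}[S - A_{λ_i - 1} + B_{i - 1}], so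
-- column operations act on all rows at once.  The divided-difference identity
--   h_{m+1}[u + Z] - h_{m+1}[v + Z] = (u - v) h_m[u + v + Z]
-- lets one subtract neighbouring columns of the numerator and factor out x_k - x_l, one diagonal
-- at a time; after n - 1 rounds the whole Vandermonde product has been extracted and column j reads
-- h_{λ_i - i + j}[x_j + ⋯ + x_n - A_{λ_i - 1} + B_{i - 1}].  The identity
--   h_{m+1}[u + Y - β] = h_{m+1}[Y] + (u - β) h_m[u + Y]
-- then adds multiples of left neighbours to the columns, sweeping from right to left, until column j
-- has gained x_1, …, x_{j-1} together with -β_1, …, -β_{j-1}: this is the right-hand side.
-- Column operations are justified by linearity of the Laplace expansion in one column and its
-- vanishing on two equal adjacent columns; since h_m = 0 for m < 0, both identities hold for all
-- integer degrees, so no boundary cases arise.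

module Submission where

open import Defs
open import Algebra.Bundles using (CommutativeRing)
import Algebra.Solver.Ring.AlmostCommutativeRing as ACR
open import Data.Bool using (Bool; true; false)
open import Data.Fin as Fin using (Fin; zero; suc; toℕ; punchIn)
import Data.Fin.Properties as Fin
open import Data.Integer as ℤ using (ℤ; +_; -[1+_])
import Data.Integer.Properties as ℤ
open import Data.Integer.Tactic.RingSolver using (solve-∀)
open import Data.List using (List; []; _∷_; _++_; [_])
import Data.List.Properties as List
open import Data.List.Relation.Binary.Permutation.Propositional as ↭ using (_↭_; ↭-reflexive)
import Data.List.Relation.Binary.Permutation.Propositional.Properties as ↭
open import Data.Maybe using (Maybe; just; nothing)
open import Data.Nat as ℕ using (ℕ; zero; suc; z≤n; s≤s; _<_; _≤_; _∸_)
import Data.Nat.Properties as ℕ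
open import Data.Product using (_×_; _,_)
open import Data.Sign as Sign using (Sign)
open import Data.Sum using (_⊎_; inj₁; inj₂)
open import Function using (_∘_)
open import Relation.Binary.PropositionalEquality as ≡ using (_≡_; _≢_)
open import Relation.Nullary using (yes; no; contradiction)

m<o∸n⇒n<o∸m : ∀ {m n o} → m < o ∸ n → n < o ∸ m
m<o∸n⇒n<o∸m {m} {n} {o} m<o∸n = ℕ.m+n≤o⇒m≤o∸n (suc n)
  (≡.subst (ℕ._≤ o) (≡.cong suc (ℕ.+-comm m n)) (ℕ.m≤o∸n⇒m+n≤o (suc m) n≤o m<o∸n))
  where
  n≤o : n ≤ o
  n≤o = ℕ.<⇒≤ (ℕ.m∸n≢0⇒n<m (λ o∸n≡0 → ℕ.n≮0 (≡.subst (m <_) o∸n≡0 m<o∸n)))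

m<o∸1+n⇒n<o∸1+m : ∀ {m n o} → m < o ∸ suc n → n < o ∸ suc m
m<o∸1+n⇒n<o∸1+m {m} {n} {o} lt = ≡.subst (n <_) (ℕ.pred[m∸n]≡m∸[1+n] o m) (ℕ.<⇒≤pred (m<o∸n⇒n<o∸m lt))

∸-suc-< : ∀ {n k} → k < n → n ∸ k ≡ suc (n ∸ suc k)
∸-suc-< (s≤s k≤n) = ℕ.+-∸-assoc 1 k≤n

e+[a-b]≡1+[e+[a-[1+b]]] : ∀ e a b → e ℤ.+ (a ℤ.- b) ≡ + 1 ℤ.+ (e ℤ.+ (a ℤ.- (+ 1 ℤ.+ b)))
e+[a-b]≡1+[e+[a-[1+b]]] = solve-∀

e+[1+a]≡1+[e+a] : ∀ e a → e ℤ.+ (+ 1 ℤ.+ a) ≡ + 1 ℤ.+ (e ℤ.+ a)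
e+[1+a]≡1+[e+a] = solve-∀

a+b≡[a-c]+[[b+c]-0] : ∀ a b c → a ℤ.+ b ≡ (a ℤ.- c) ℤ.+ ((b ℤ.+ c) ℤ.- + 0)
a+b≡[a-c]+[[b+c]-0] = solve-∀

[a+b]-a≡b : ∀ a b → (a ℤ.+ b) ℤ.- a ≡ b
[a+b]-a≡b = solve-∀

punchInℕ : ℕ → ℕ → ℕ
punchInℕ zero k = suc k
punchInℕ (suc j) zero = zero
punchInℕ (suc j) (suc k) = suc (punchInℕ j k)

-- punchOutℕ j a is the inverse of punchInℕ j; its value at a ≡ j is junk.
punchOutℕ : ℕ → ℕ → ℕ
punchOutℕ zero zero = zero
punchOutℕ zero (suc a) = a
punchOutℕ (suc j) zero = zero
punchOutℕ (suc j) (suc a) = suc (punchOutℕ j a)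

toℕ-punchIn : ∀ {n} (j : Fin (suc n)) (k : Fin n) → toℕ (punchIn j k) ≡ punchInℕ (toℕ j) (toℕ k)
toℕ-punchIn zero k = ≡.refl
toℕ-punchIn (suc j) zero = ≡.refl
toℕ-punchIn (suc j) (suc k) = ≡.cong suc (toℕ-punchIn j k)

punchInℕᵢ≢i : ∀ j k → punchInℕ j k ≢ j
punchInℕᵢ≢i (suc j) (suc k) = punchInℕᵢ≢i j k ∘ ℕ.suc-injective

punchInℕ-punchOutℕ : ∀ {j a} → j ≢ a → punchInℕ j (punchOutℕ j a) ≡ a
punchInℕ-punchOutℕ {zero} {zero} j≢a = contradiction ≡.refl j≢a
punchInℕ-punchOutℕ {zero} {suc a} _ = ≡.refl
punchInℕ-punchOutℕ {suc j} {zero} _ = ≡.refl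
punchInℕ-punchOutℕ {suc j} {suc a} j≢a = ≡.cong suc (punchInℕ-punchOutℕ (j≢a ∘ ≡.cong suc))

punchOutℕ-punchInℕ : ∀ j k → punchOutℕ j (punchInℕ j k) ≡ k
punchOutℕ-punchInℕ zero k = ≡.refl
punchOutℕ-punchInℕ (suc j) zero = ≡.refl
punchOutℕ-punchInℕ (suc j) (suc k) = ≡.cong suc (punchOutℕ-punchInℕ j k)

punchInℕ-< : ∀ {n} j {k} → k < n → punchInℕ j k < suc n
punchInℕ-< zero k<n = s≤s k<n
punchInℕ-< (suc j) {zero} k<n = s≤s z≤n
punchInℕ-< (suc j) {suc k} (s≤s k<n) = s≤s (punchInℕ-< j k<n)

punchOutℕ-< : ∀ {n j a} → j < suc n → a < suc n → j ≢ a → punchOutℕ j a < n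
punchOutℕ-< {j = zero} {zero} _ _ j≢a = contradiction ≡.refl j≢a
punchOutℕ-< {j = zero} {suc a} _ (s≤s a<n) _ = a<n
punchOutℕ-< {zero} {suc j} {zero} (s≤s ()) _ _
punchOutℕ-< {suc n} {suc j} {zero} _ _ _ = s≤s z≤n
punchOutℕ-< {suc n} {suc j} {suc a} (s≤s j<) (s≤s a<) j≢a = s≤s (punchOutℕ-< j< a< (j≢a ∘ ≡.cong suc))

punchInℕ-diag : ∀ a → punchInℕ a a ≡ suc a
punchInℕ-diag zero = ≡.refl
punchInℕ-diag (suc a) = ≡.cong suc (punchInℕ-diag a)

punchInℕ-suc-diag : ∀ a → punchInℕ (suc a) a ≡ a
punchInℕ-suc-diag zero = ≡.refl
punchInℕ-suc-diag (suc a) = ≡.cong suc (punchInℕ-suc-diag a)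

punchInℕ-suc : ∀ {a k} → k ≢ a → punchInℕ a k ≡ punchInℕ (suc a) k
punchInℕ-suc {zero} {zero} k≢a = contradiction ≡.refl k≢a
punchInℕ-suc {zero} {suc k} _ = ≡.refl
punchInℕ-suc {suc a} {zero} _ = ≡.refl
punchInℕ-suc {suc a} {suc k} k≢a = ≡.cong suc (punchInℕ-suc (k≢a ∘ ≡.cong suc))

punchOutℕ-suc : ∀ {j a} → j ≢ a → j ≢ suc a → punchOutℕ j (suc a) ≡ suc (punchOutℕ j a)
punchOutℕ-suc {zero} {zero} j≢a _ = contradiction ≡.refl j≢a
punchOutℕ-suc {zero} {suc a} _ _ = ≡.refl
punchOutℕ-suc {suc zero} {zero} _ j≢1 = contradiction ≡.refl j≢1
punchOutℕ-suc {suc (suc j)} {zero} _ _ = ≡.refl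
punchOutℕ-suc {suc j} {suc a} j≢a j≢sa = ≡.cong suc (punchOutℕ-suc (j≢a ∘ ≡.cong suc) (j≢sa ∘ ≡.cong suc))

extend : ∀ {a} {B : Set a} {n} → B → (Fin n → B) → ℕ → B
extend {n = zero} d f k = d
extend {n = suc n} d f zero = f zero
extend {n = suc n} d f (suc k) = extend d (f ∘ suc) k

extend-toℕ : ∀ {a} {B : Set a} {n} (d : B) (f : Fin n → B) (i : Fin n) → extend d f (toℕ i) ≡ f i
extend-toℕ d f zero = ≡.refl
extend-toℕ d f (suc i) = extend-toℕ d (f ∘ suc) i

module _ {a} {X : Set a} where
  open ↭.PermutationReasoning

  ++-snoc↭∷ : ∀ (xs : List X) v ys → (xs ++ [ v ]) ++ ys ↭ v ∷ xs ++ ys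
  ++-snoc↭∷ xs v ys = begin
    (xs ++ [ v ]) ++ ys   ≡⟨ List.++-assoc xs [ v ] ys ⟩
    xs ++ [ v ] ++ ys     ↭⟨ ↭.shift v xs ys ⟩
    v ∷ xs ++ ys          ∎

  ∷-++-∷↭ : ∀ u (xs : List X) v ys zs → ((u ∷ xs) ++ (v ∷ ys)) ++ zs ↭ v ∷ u ∷ (xs ++ ys) ++ zs
  ∷-++-∷↭ u xs v ys zs = begin
    u ∷ (xs ++ v ∷ ys) ++ zs      ↭⟨ ↭.prep u (↭.++⁺ʳ zs (↭.shift v xs ys)) ⟩
    u ∷ v ∷ (xs ++ ys) ++ zs      ↭⟨ ↭.swap u v ↭.refl ⟩
    v ∷ u ∷ (xs ++ ys) ++ zs      ∎

  ++-rotate↭ : ∀ (ws xs ys zs : List X) → (ws ++ zs) ++ (xs ++ ys) ↭ ws ++ (xs ++ (ys ++ zs))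
  ++-rotate↭ ws xs ys zs = begin
    (ws ++ zs) ++ (xs ++ ys)    ≡⟨ List.++-assoc ws zs (xs ++ ys) ⟩
    ws ++ (zs ++ (xs ++ ys))    ↭⟨ ↭.++⁺ˡ ws (↭.++-comm zs (xs ++ ys)) ⟩
    ws ++ ((xs ++ ys) ++ zs)    ≡⟨ ≡.cong (ws ++_) (List.++-assoc xs ys zs) ⟩
    ws ++ (xs ++ (ys ++ zs))    ∎

-- The normal forms compared by the solver must have coefficients with decidable equality, so that
-- e.g. 1 - 1 is recognised as 0; hence coefficients are taken from ℤ through its image in R.
module IntegerCoefficientRingSolver {c ℓ} (R : CommutativeRing c ℓ) where
  open CommutativeRing R
  open import Relation.Binary.Reasoning.Setoid setoid
  open import Algebra.Properties.Semiring.Mult semiring using (×-homo-1; ×-homo-+; ×1-homo-*) renaming (_×_ to _×′_)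
  open import Algebra.Properties.Ring ring using (-1*x≈-x; -0#≈0#)
  open import Algebra.Properties.AbelianGroup +-abelianGroup using (⁻¹-∙-comm; ⁻¹-involutive)
  open import Algebra.Properties.CommutativeSemigroup *-commutativeSemigroup using (interchange)

  ⟦_⟧ℤ : ℤ → Carrier
  ⟦ + n ⟧ℤ = n ×′ 1#
  ⟦ -[1+ n ] ⟧ℤ = - (suc n ×′ 1#)

  private
    cancelˡ : ∀ a b → a - b ≈ (1# + a) - (1# + b)
    cancelˡ a b = begin
      a - b                          ≈⟨ +-identityˡ _ ⟨
      0# + (a - b)                   ≈⟨ +-congʳ (-‿inverseʳ 1#) ⟨
      (1# - 1#) + (a - b)            ≈⟨ +-assoc _ _ _ ⟩
      1# + (- 1# + (a - b))          ≈⟨ +-congˡ (+-assoc _ _ _) ⟨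
      1# + ((- 1# + a) - b)          ≈⟨ +-congˡ (+-congʳ (+-comm _ _)) ⟩
      1# + ((a - 1#) - b)            ≈⟨ +-congˡ (+-assoc _ _ _) ⟩
      1# + (a + (- 1# - b))          ≈⟨ +-congˡ (+-congˡ (⁻¹-∙-comm 1# b)) ⟩
      1# + (a - (1# + b))            ≈⟨ +-assoc _ _ _ ⟨
      (1# + a) - (1# + b)            ∎

    ⊖-homo : ∀ m n → ⟦ m ℤ.⊖ n ⟧ℤ ≈ m ×′ 1# - n ×′ 1#
    ⊖-homo m zero = sym (trans (+-congˡ -0#≈0#) (+-identityʳ _))
    ⊖-homo zero (suc n) = sym (+-identityˡ _)
    ⊖-homo (suc m) (suc n) = begin
      ⟦ suc m ℤ.⊖ suc n ⟧ℤ        ≡⟨ ≡.cong ⟦_⟧ℤ (ℤ.[1+m]⊖[1+n]≡m⊖n m n) ⟩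
      ⟦ m ℤ.⊖ n ⟧ℤ                ≈⟨ ⊖-homo m n ⟩
      m ×′ 1# - n ×′ 1#           ≈⟨ cancelˡ (m ×′ 1#) (n ×′ 1#) ⟩
      suc m ×′ 1# - suc n ×′ 1#   ∎

    +-homo : ∀ i j → ⟦ i ℤ.+ j ⟧ℤ ≈ ⟦ i ⟧ℤ + ⟦ j ⟧ℤ
    +-homo (+ m) (+ n) = ×-homo-+ 1# m n
    +-homo (+ m) -[1+ n ] = ⊖-homo m (suc n)
    +-homo -[1+ m ] (+ n) = trans (⊖-homo n (suc m)) (+-comm _ _)
    +-homo -[1+ m ] -[1+ n ] = begin
      - (suc (suc (m ℕ.+ n)) ×′ 1#)    ≡⟨ ≡.cong (λ k → - (suc k ×′ 1#)) (ℕ.+-suc m n) ⟨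
      - ((suc m ℕ.+ suc n) ×′ 1#)      ≈⟨ -‿cong (×-homo-+ 1# (suc m) (suc n)) ⟩
      - (suc m ×′ 1# + suc n ×′ 1#)    ≈⟨ ⁻¹-∙-comm _ _ ⟨
      - (suc m ×′ 1#) - suc n ×′ 1#    ∎

    -‿homo : ∀ i → ⟦ ℤ.- i ⟧ℤ ≈ - ⟦ i ⟧ℤ
    -‿homo (+ zero) = sym -0#≈0#
    -‿homo (+ suc n) = refl
    -‿homo -[1+ n ] = sym (⁻¹-involutive _)

    ⟦_⟧ₛ : Sign → Carrier
    ⟦ Sign.+ ⟧ₛ = 1#
    ⟦ Sign.- ⟧ₛ = - 1#

    *-homoₛ : ∀ s t → ⟦ s Sign.* t ⟧ₛ ≈ ⟦ s ⟧ₛ * ⟦ t ⟧ₛ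
    *-homoₛ Sign.+ t = sym (*-identityˡ _)
    *-homoₛ Sign.- Sign.+ = sym (*-identityʳ _)
    *-homoₛ Sign.- Sign.- = sym (trans (-1*x≈-x (- 1#)) (⁻¹-involutive 1#))

    ◃-homo : ∀ s n → ⟦ s ℤ.◃ n ⟧ℤ ≈ ⟦ s ⟧ₛ * (n ×′ 1#)
    ◃-homo s zero = sym (zeroʳ _)
    ◃-homo Sign.+ (suc n) = sym (*-identityˡ _)
    ◃-homo Sign.- (suc n) = sym (-1*x≈-x _)

    sign-abs : ∀ i → ⟦ i ⟧ℤ ≈ ⟦ ℤ.sign i ⟧ₛ * (ℤ.∣ i ∣ ×′ 1#)
    sign-abs (+ n) = sym (*-identityˡ _)
    sign-abs -[1+ n ] = sym (-1*x≈-x _)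

    *-homo : ∀ i j → ⟦ i ℤ.* j ⟧ℤ ≈ ⟦ i ⟧ℤ * ⟦ j ⟧ℤ
    *-homo i j = begin
      ⟦ i ℤ.* j ⟧ℤ
        ≈⟨ ◃-homo (ℤ.sign i Sign.* ℤ.sign j) (ℤ.∣ i ∣ ℕ.* ℤ.∣ j ∣) ⟩
      ⟦ ℤ.sign i Sign.* ℤ.sign j ⟧ₛ * ((ℤ.∣ i ∣ ℕ.* ℤ.∣ j ∣) ×′ 1#)
        ≈⟨ *-cong (*-homoₛ (ℤ.sign i) (ℤ.sign j)) (×1-homo-* ℤ.∣ i ∣ ℤ.∣ j ∣) ⟩
      (⟦ ℤ.sign i ⟧ₛ * ⟦ ℤ.sign j ⟧ₛ) * ((ℤ.∣ i ∣ ×′ 1#) * (ℤ.∣ j ∣ ×′ 1#))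
        ≈⟨ interchange _ _ _ _ ⟩
      (⟦ ℤ.sign i ⟧ₛ * (ℤ.∣ i ∣ ×′ 1#)) * (⟦ ℤ.sign j ⟧ₛ * (ℤ.∣ j ∣ ×′ 1#))
        ≈⟨ *-cong (sign-abs i) (sign-abs j) ⟨
      ⟦ i ⟧ℤ * ⟦ j ⟧ℤ ∎

    homomorphism : ℤ.+-*-rawRing ACR.-Raw-AlmostCommutative⟶ ACR.fromCommutativeRing R
    homomorphism = record
      { ⟦_⟧ = ⟦_⟧ℤ ; +-homo = +-homo ; *-homo = *-homo ; -‿homo = -‿homo
      ; 0-homo = refl ; 1-homo = ×-homo-1 1# }

    ≟-lift : ∀ i j → Maybe (⟦ i ⟧ℤ ≈ ⟦ j ⟧ℤ)
    ≟-lift i j with i ℤ.≟ j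
    ... | yes ≡.refl = just refl
    ... | no _ = nothing

  open import Algebra.Solver.Ring ℤ.+-*-rawRing (ACR.fromCommutativeRing R) homomorphism ≟-lift public

module Determinant {c ℓ} (R : CommutativeRing c ℓ) where
  open CommutativeRing R renaming (Carrier to A) hiding (zero)
  open import Relation.Binary.Reasoning.Setoid setoid
  open import Algebra.Properties.Ring ring using (-1*x≈-x)
  open IntegerCoefficientRingSolver R using (solve; _:=_; _:+_; _:*_; _:-_; con)
  open import Algebra.Properties.CommutativeSemigroup *-commutativeSemigroup using (interchange; x∙yz≈y∙xz)

  altSum-cong : ∀ {n} {f g : Fin n → A} → (∀ j → f j ≈ g j) → altSum R f ≈ altSum R g
  altSum-cong {zero} _ = refl
  altSum-cong {suc n} f≈g = +-cong (f≈g zero) (-‿cong (altSum-cong (f≈g ∘ suc)))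

  prodFin-cong : ∀ {n} {f g : Fin n → A} → (∀ j → f j ≈ g j) → prodFin R f ≈ prodFin R g
  prodFin-cong {zero} _ = refl
  prodFin-cong {suc n} f≈g = *-cong (f≈g zero) (prodFin-cong (f≈g ∘ suc))

  det-cong : ∀ n {M M' : Fin n → Fin n → A} → (∀ i j → M i j ≈ M' i j) → det R n M ≈ det R n M'
  det-cong zero _ = refl
  det-cong (suc n) M≈M' =
    altSum-cong (λ j → *-cong (M≈M' zero j) (det-cong n (λ i k → M≈M' (suc i) (punchIn j k))))

  -- Matrices are indexed by ℕ so that index arithmetic stays in ℕ; detℕ n reads the entries below n.
  Matrix : Set c
  Matrix = ℕ → ℕ → A

  detℕ : ℕ → Matrix → A
  detℕ n M = det R n (λ i j → M (toℕ i) (toℕ j))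

  altSumℕ : ℕ → (ℕ → A) → A
  altSumℕ n f = altSum R {n} (f ∘ toℕ)

  prodℕ : ℕ → (ℕ → A) → A
  prodℕ n f = prodFin R {n} (f ∘ toℕ)

  minor : ℕ → Matrix → Matrix
  minor j M r k = M (suc r) (punchInℕ j k)

  altSumℕ-cong : ∀ n {f g : ℕ → A} → (∀ j → j < n → f j ≈ g j) → altSumℕ n f ≈ altSumℕ n g
  altSumℕ-cong n f≈g = altSum-cong (λ j → f≈g (toℕ j) (Fin.toℕ<n j))

  prodℕ-cong : ∀ n {f g : ℕ → A} → (∀ j → j < n → f j ≈ g j) → prodℕ n f ≈ prodℕ n g
  prodℕ-cong n f≈g = prodFin-cong (λ j → f≈g (toℕ j) (Fin.toℕ<n j))

  detℕ-cong : ∀ n {M M' : Matrix} → (∀ r k → r < n → k < n → M r k ≈ M' r k) → detℕ n M ≈ detℕ n M'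
  detℕ-cong n M≈M' = det-cong n (λ i j → M≈M' (toℕ i) (toℕ j) (Fin.toℕ<n i) (Fin.toℕ<n j))

  detℕ-expand : ∀ n (M : Matrix) → detℕ (suc n) M ≈ altSumℕ (suc n) (λ j → M 0 j * detℕ n (minor j M))
  detℕ-expand n M = altSum-cong (λ j → *-congˡ {M 0 (toℕ j)}
    (det-cong n (λ i k → reflexive (≡.cong (M (suc (toℕ i))) (toℕ-punchIn j k)))))

  altSumℕ-linear : ∀ n (f g : ℕ → A) s →
    altSumℕ n (λ j → f j + s * g j) ≈ altSumℕ n f + s * altSumℕ n g
  altSumℕ-linear zero f g s = solve 1 (λ s → con (+ 0) := con (+ 0) :+ s :* con (+ 0)) refl s
  altSumℕ-linear (suc n) f g s = begin
    (f 0 + s * g 0) - altSumℕ n (λ j → f (suc j) + s * g (suc j))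
      ≈⟨ +-congˡ (-‿cong (altSumℕ-linear n (f ∘ suc) (g ∘ suc) s)) ⟩
    (f 0 + s * g 0) - (altSumℕ n (f ∘ suc) + s * altSumℕ n (g ∘ suc))
      ≈⟨ solve 5 (λ a b s x y → (a :+ s :* b) :- (x :+ s :* y) := (a :- x) :+ s :* (b :- y)) refl
           (f 0) (g 0) s (altSumℕ n (f ∘ suc)) (altSumℕ n (g ∘ suc)) ⟩
    (f 0 - altSumℕ n (f ∘ suc)) + s * (g 0 - altSumℕ n (g ∘ suc)) ∎

  altSumℕ-zero : ∀ n (f : ℕ → A) → (∀ j → j < n → f j ≈ 0#) → altSumℕ n f ≈ 0#
  altSumℕ-zero zero f _ = refl
  altSumℕ-zero (suc n) f f≈0 = begin
    f 0 - altSumℕ n (f ∘ suc)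
      ≈⟨ +-cong (f≈0 0 (s≤s z≤n)) (-‿cong (altSumℕ-zero n (f ∘ suc) (λ j → f≈0 (suc j) ∘ s≤s))) ⟩
    0# - 0#  ≈⟨ -‿inverseʳ 0# ⟩
    0#       ∎

  -- Consecutive terms enter an alternating sum with opposite signs.
  altSumℕ-adjacent : ∀ n (f : ℕ → A) a → suc a < n → f a ≈ f (suc a) →
    (∀ j → j < n → j ≢ a → j ≢ suc a → f j ≈ 0#) → altSumℕ n f ≈ 0#
  altSumℕ-adjacent (suc (suc n)) f zero _ f0≈f1 others = begin
    f 0 - (f 1 - altSumℕ n (λ j → f (suc (suc j))))
      ≈⟨ +-cong f0≈f1 (-‿cong (+-congˡ (-‿cong (altSumℕ-zero n (λ j → f (suc (suc j)))
           (λ j j<n → others (suc (suc j)) (s≤s (s≤s j<n)) (λ ()) (λ ())))))) ⟩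
    f 1 - (f 1 - 0#)
      ≈⟨ solve 1 (λ x → x :- (x :- con (+ 0)) := con (+ 0)) refl (f 1) ⟩
    0# ∎
  altSumℕ-adjacent (suc n) f (suc a) (s≤s sa<n) fa≈fsa others = begin
    f 0 - altSumℕ n (f ∘ suc)
      ≈⟨ +-cong (others 0 (s≤s z≤n) (λ ()) (λ ()))
           (-‿cong (altSumℕ-adjacent n (f ∘ suc) a sa<n fa≈fsa
             (λ j j<n j≢a j≢sa → others (suc j) (s≤s j<n) (j≢a ∘ ℕ.suc-injective) (j≢sa ∘ ℕ.suc-injective)))) ⟩
    0# - 0#  ≈⟨ -‿inverseʳ 0# ⟩
    0#       ∎

  prodℕ-punchIn : ∀ n (s : ℕ → A) {j} → j < suc n → prodℕ (suc n) s ≈ s j * prodℕ n (s ∘ punchInℕ j)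
  prodℕ-punchIn n s {zero} _ = refl
  prodℕ-punchIn (suc n) s {suc j} (s≤s j<sn) = begin
    s 0 * prodℕ (suc n) (s ∘ suc)                            ≈⟨ *-congˡ (prodℕ-punchIn n (s ∘ suc) j<sn) ⟩
    s 0 * (s (suc j) * prodℕ n (s ∘ suc ∘ punchInℕ j))       ≈⟨ x∙yz≈y∙xz _ _ _ ⟩
    s (suc j) * (s 0 * prodℕ n (s ∘ suc ∘ punchInℕ j))       ∎

  prodℕ-snoc : ∀ m (g : ℕ → A) → prodℕ (suc m) g ≈ prodℕ m g * g m
  prodℕ-snoc zero g = trans (*-identityʳ _) (sym (*-identityˡ _))
  prodℕ-snoc (suc m) g = trans (*-congˡ (prodℕ-snoc m (g ∘ suc))) (sym (*-assoc _ _ _))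

  prodℕ-mul : ∀ n (f g : ℕ → A) → prodℕ n f * prodℕ n g ≈ prodℕ n (λ k → f k * g k)
  prodℕ-mul zero f g = *-identityˡ 1#
  prodℕ-mul (suc n) f g = trans (interchange _ _ _ _) (*-congˡ (prodℕ-mul n (f ∘ suc) (g ∘ suc)))

  prodℕ-one : ∀ n → prodℕ n (λ _ → 1#) ≈ 1#
  prodℕ-one zero = refl
  prodℕ-one (suc n) = trans (*-identityˡ _) (prodℕ-one n)

  altSumℕ-scale : ∀ n s (f : ℕ → A) → altSumℕ n (λ j → s * f j) ≈ s * altSumℕ n f
  altSumℕ-scale zero s f = sym (zeroʳ s)
  altSumℕ-scale (suc n) s f = begin
    s * f 0 - altSumℕ n (λ j → s * f (suc j))  ≈⟨ +-congˡ (-‿cong (altSumℕ-scale n s (f ∘ suc))) ⟩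
    s * f 0 - s * altSumℕ n (f ∘ suc)          ≈⟨ solve 3 (λ s a b → s :* a :- s :* b := s :* (a :- b)) refl s (f 0) _ ⟩
    s * (f 0 - altSumℕ n (f ∘ suc))            ∎

  detℕ-scaleColumns : ∀ n (s : ℕ → A) (M : Matrix) →
    detℕ n (λ r k → s k * M r k) ≈ prodℕ n s * detℕ n M
  detℕ-scaleColumns zero s M = sym (*-identityʳ 1#)
  detℕ-scaleColumns (suc n) s M = begin
    detℕ (suc n) (λ r k → s k * M r k)
      ≈⟨ detℕ-expand n (λ r k → s k * M r k) ⟩
    altSumℕ (suc n) (λ j → (s j * M 0 j) * detℕ n (λ r k → s (punchInℕ j k) * minor j M r k))
      ≈⟨ altSumℕ-cong (suc n) term ⟩
    altSumℕ (suc n) (λ j → prodℕ (suc n) s * (M 0 j * detℕ n (minor j M)))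
      ≈⟨ altSumℕ-scale (suc n) (prodℕ (suc n) s) (λ j → M 0 j * detℕ n (minor j M)) ⟩
    prodℕ (suc n) s * altSumℕ (suc n) (λ j → M 0 j * detℕ n (minor j M))
      ≈⟨ *-congˡ (detℕ-expand n M) ⟨
    prodℕ (suc n) s * detℕ (suc n) M ∎
    where
    term : ∀ j → j < suc n →
      (s j * M 0 j) * detℕ n (λ r k → s (punchInℕ j k) * minor j M r k)
        ≈ prodℕ (suc n) s * (M 0 j * detℕ n (minor j M))
    term j j<sn = begin
      (s j * M 0 j) * detℕ n (λ r k → s (punchInℕ j k) * minor j M r k)
        ≈⟨ *-congˡ (detℕ-scaleColumns n (s ∘ punchInℕ j) (minor j M)) ⟩
      (s j * M 0 j) * (prodℕ n (s ∘ punchInℕ j) * detℕ n (minor j M))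
        ≈⟨ interchange _ _ _ _ ⟩
      s j * prodℕ n (s ∘ punchInℕ j) * (M 0 j * detℕ n (minor j M))
        ≈⟨ *-congʳ (prodℕ-punchIn n s j<sn) ⟨
      prodℕ (suc n) s * (M 0 j * detℕ n (minor j M)) ∎

  minor-agree : ∀ {n} {M M' : Matrix} a j → j < suc n →
    (∀ r k → r < suc n → k < suc n → k ≢ a → M r k ≈ M' r k) →
    ∀ r k → r < n → k < n → k ≢ punchOutℕ j a → minor j M r k ≈ minor j M' r k
  minor-agree a j j<sn M≈M' r k r<n k<n k≢a′ = M≈M' (suc r) (punchInℕ j k) (s≤s r<n) (punchInℕ-< j k<n)
    (λ jk≡a → k≢a′ (≡.trans (≡.sym (punchOutℕ-punchInℕ j k)) (≡.cong (punchOutℕ j) jk≡a)))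

  detℕ-linearInColumn : ∀ n a s {M₁ M₂ M : Matrix} → a < n →
    (∀ r k → r < n → k < n → k ≢ a → M r k ≈ M₁ r k) →
    (∀ r k → r < n → k < n → k ≢ a → M r k ≈ M₂ r k) →
    (∀ r → r < n → M r a ≈ M₁ r a + s * M₂ r a) →
    detℕ n M ≈ detℕ n M₁ + s * detℕ n M₂
  detℕ-linearInColumn (suc n) a s {M₁} {M₂} {M} a<n M≈M₁ M≈M₂ Ma≈ = begin
    detℕ (suc n) M                               ≈⟨ detℕ-expand n M ⟩
    altSumℕ (suc n) (λ j → M 0 j * D M j)        ≈⟨ altSumℕ-cong (suc n) term ⟩
    altSumℕ (suc n) (λ j → M₁ 0 j * D M₁ j + s * (M₂ 0 j * D M₂ j))
      ≈⟨ altSumℕ-linear (suc n) (λ j → M₁ 0 j * D M₁ j) (λ j → M₂ 0 j * D M₂ j) s ⟩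
    altSumℕ (suc n) (λ j → M₁ 0 j * D M₁ j) + s * altSumℕ (suc n) (λ j → M₂ 0 j * D M₂ j)
      ≈⟨ +-cong (detℕ-expand n M₁) (*-congˡ (detℕ-expand n M₂)) ⟨
    detℕ (suc n) M₁ + s * detℕ (suc n) M₂        ∎
    where
    D : Matrix → ℕ → A
    D N j = detℕ n (minor j N)
    term : ∀ j → j < suc n → M 0 j * D M j ≈ M₁ 0 j * D M₁ j + s * (M₂ 0 j * D M₂ j)
    term j j<sn with j ℕ.≟ a
    ... | yes ≡.refl = begin
      M 0 j * D M j                       ≈⟨ *-congʳ (Ma≈ 0 (s≤s z≤n)) ⟩
      (M₁ 0 j + s * M₂ 0 j) * D M j       ≈⟨ solve 4 (λ x s y d → (x :+ s :* y) :* d := x :* d :+ s :* (y :* d)) refl _ s _ _ ⟩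
      M₁ 0 j * D M j + s * (M₂ 0 j * D M j)
        ≈⟨ +-cong (*-congˡ (detℕ-cong n (λ r k r<n k<n →
                    M≈M₁ (suc r) _ (s≤s r<n) (punchInℕ-< j k<n) (punchInℕᵢ≢i j k))))
                  (*-congˡ (*-congˡ (detℕ-cong n (λ r k r<n k<n →
                    M≈M₂ (suc r) _ (s≤s r<n) (punchInℕ-< j k<n) (punchInℕᵢ≢i j k))))) ⟩
      M₁ 0 j * D M₁ j + s * (M₂ 0 j * D M₂ j) ∎
    ... | no j≢a = begin
      M 0 j * D M j
        ≈⟨ *-congˡ (detℕ-linearInColumn n (punchOutℕ j a) s (punchOutℕ-< j<sn a<n j≢a)
             (minor-agree a j j<sn M≈M₁) (minor-agree a j j<sn M≈M₂)
             (λ r r<n → ≡.subst (λ k → M (suc r) k ≈ M₁ (suc r) k + s * M₂ (suc r) k)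
                          (≡.sym (punchInℕ-punchOutℕ j≢a)) (Ma≈ (suc r) (s≤s r<n)))) ⟩
      M 0 j * (D M₁ j + s * D M₂ j)
        ≈⟨ solve 4 (λ x d s e → x :* (d :+ s :* e) := x :* d :+ s :* (x :* e)) refl _ _ s _ ⟩
      M 0 j * D M₁ j + s * (M 0 j * D M₂ j)
        ≈⟨ +-cong (*-congʳ (M≈M₁ 0 j (s≤s z≤n) j<sn j≢a)) (*-congˡ (*-congʳ (M≈M₂ 0 j (s≤s z≤n) j<sn j≢a))) ⟩
      M₁ 0 j * D M₁ j + s * (M₂ 0 j * D M₂ j) ∎

  detℕ-adjacentEqualColumns : ∀ n (M : Matrix) a → suc a < n →
    (∀ r → r < n → M r a ≈ M r (suc a)) → detℕ n M ≈ 0#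
  detℕ-adjacentEqualColumns (suc n) M a sa<n Ma≈Msa = begin
    detℕ (suc n) M                                  ≈⟨ detℕ-expand n M ⟩
    altSumℕ (suc n) (λ j → M 0 j * detℕ n (minor j M)) ≈⟨ altSumℕ-adjacent (suc n) _ a sa<n adjacent others ⟩
    0#                                              ∎
    where
    minorsEqual : ∀ r k → r < n → minor a M r k ≈ minor (suc a) M r k
    minorsEqual r k r<n with k ℕ.≟ a
    ... | yes ≡.refl = ≡.subst₂ (λ u v → M (suc r) u ≈ M (suc r) v)
                         (≡.sym (punchInℕ-diag k)) (≡.sym (punchInℕ-suc-diag k)) (sym (Ma≈Msa (suc r) (s≤s r<n)))
    ... | no k≢a = reflexive (≡.cong (M (suc r)) (punchInℕ-suc k≢a))
    adjacent : M 0 a * detℕ n (minor a M) ≈ M 0 (suc a) * detℕ n (minor (suc a) M)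
    adjacent = *-cong (Ma≈Msa 0 (s≤s z≤n)) (detℕ-cong n (λ r k r<n _ → minorsEqual r k r<n))
    others : ∀ j → j < suc n → j ≢ a → j ≢ suc a → M 0 j * detℕ n (minor j M) ≈ 0#
    others j j<sn j≢a j≢sa = begin
      M 0 j * detℕ n (minor j M)
        ≈⟨ *-congˡ (detℕ-adjacentEqualColumns n (minor j M) (punchOutℕ j a)
             (≡.subst (_< n) (punchOutℕ-suc j≢a j≢sa) (punchOutℕ-< j<sn sa<n j≢sa))
             (λ r r<n → ≡.subst₂ (λ u v → M (suc r) u ≈ M (suc r) v)
                (≡.sym (punchInℕ-punchOutℕ j≢a))
                (≡.trans (≡.sym (punchInℕ-punchOutℕ j≢sa)) (≡.cong (punchInℕ j) (punchOutℕ-suc j≢a j≢sa)))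
                (Ma≈Msa (suc r) (s≤s r<n)))) ⟩
      M 0 j * 0#  ≈⟨ zeroʳ _ ⟩
      0#          ∎

  setColumn : Matrix → ℕ → (ℕ → A) → Matrix
  setColumn M a v r k with k ℕ.≟ a
  ... | yes _ = v r
  ... | no _ = M r k

  setColumn-≡ : ∀ M a v r → setColumn M a v r a ≡ v r
  setColumn-≡ M a v r with a ℕ.≟ a
  ... | yes _ = ≡.refl
  ... | no a≢a = contradiction ≡.refl a≢a

  setColumn-≢ : ∀ M a v r {k} → k ≢ a → setColumn M a v r k ≡ M r k
  setColumn-≢ M a v r {k} k≢a with k ℕ.≟ a
  ... | yes k≡a = contradiction k≡a k≢a
  ... | no _ = ≡.refl

  detℕ-addAdjacentColumn : ∀ n a b t {M M' : Matrix} → a < n → b < n → suc a ≡ b ⊎ suc b ≡ a →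
    (∀ r k → r < n → k < n → k ≢ a → M' r k ≈ M r k) →
    (∀ r → r < n → M' r a ≈ M r a + t * M r b) →
    detℕ n M' ≈ detℕ n M
  detℕ-addAdjacentColumn n a b t {M} {M'} a<n b<n adjacent M'≈M M'a≈ = begin
    detℕ n M'                ≈⟨ detℕ-linearInColumn n a t a<n M'≈M M'≈Mb M'a≈′ ⟩
    detℕ n M + t * detℕ n Mb ≈⟨ +-congˡ (*-congˡ (Mb≈0 adjacent)) ⟩
    detℕ n M + t * 0#        ≈⟨ +-congˡ (zeroʳ t) ⟩
    detℕ n M + 0#            ≈⟨ +-identityʳ _ ⟩
    detℕ n M                 ∎
    where
    Mb : Matrix
    Mb = setColumn M a (λ r → M r b)
    Mb-≡ : ∀ r → Mb r a ≡ M r b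
    Mb-≡ = setColumn-≡ M a (λ r → M r b)
    Mb-≢ : ∀ r {k} → k ≢ a → Mb r k ≡ M r k
    Mb-≢ = setColumn-≢ M a (λ r → M r b)
    M'≈Mb : ∀ r k → r < n → k < n → k ≢ a → M' r k ≈ Mb r k
    M'≈Mb r k r<n k<n k≢a = trans (M'≈M r k r<n k<n k≢a) (reflexive (≡.sym (Mb-≢ r k≢a)))
    M'a≈′ : ∀ r → r < n → M' r a ≈ M r a + t * Mb r a
    M'a≈′ r r<n = trans (M'a≈ r r<n) (+-congˡ (*-congˡ (reflexive (≡.sym (Mb-≡ r)))))
    Mb≈0 : suc a ≡ b ⊎ suc b ≡ a → detℕ n Mb ≈ 0#
    Mb≈0 (inj₁ sa≡b) = detℕ-adjacentEqualColumns n Mb a (≡.subst (_< n) (≡.sym sa≡b) b<n) (λ r _ → begin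
      Mb r a         ≡⟨ Mb-≡ r ⟩
      M r b          ≡⟨ ≡.cong (M r) sa≡b ⟨
      M r (suc a)    ≡⟨ Mb-≢ r ℕ.1+n≢n ⟨
      Mb r (suc a)   ∎)
    Mb≈0 (inj₂ sb≡a) = detℕ-adjacentEqualColumns n Mb b (≡.subst (_< n) (≡.sym sb≡a) a<n) (λ r _ → begin
      Mb r b         ≡⟨ Mb-≢ r (λ b≡a → ℕ.1+n≢n (≡.trans sb≡a (≡.sym b≡a))) ⟩
      M r b          ≡⟨ Mb-≡ r ⟨
      Mb r a         ≡⟨ ≡.cong (Mb r) sb≡a ⟨
      Mb r (suc b)   ∎)

  -- Undo the operation on the last swept column L, whose partner column suc L is untouched.
  detℕ-sweepRight : ∀ n (t : ℕ → A) {M M' : Matrix} L → L < n →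
    (∀ r k → r < n → k < L → M' r k ≈ M r k + t k * M r (suc k)) →
    (∀ r k → r < n → L ≤ k → k < n → M' r k ≈ M r k) →
    detℕ n M' ≈ detℕ n M
  detℕ-sweepRight n t zero _ _ unchanged = detℕ-cong n (λ r k r<n k<n → unchanged r k r<n z≤n k<n)
  detℕ-sweepRight n t {M} {M'} (suc L) sL<n swept unchanged = begin
    detℕ n M'   ≈⟨ detℕ-addAdjacentColumn n L (suc L) (t L) L<n sL<n (inj₁ ≡.refl)
                     (λ r k _ _ k≢L → reflexive (≡.sym (M″-≢ r k≢L)))
                     (λ r r<n → trans (swept r L r<n (ℕ.n<1+n L))
                        (+-cong (reflexive (≡.sym (M″-≡ r)))
                                (*-congˡ (trans (sym (unchanged r (suc L) r<n ℕ.≤-refl sL<n))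
                                                (reflexive (≡.sym (M″-≢ r ℕ.1+n≢n))))))) ⟩
    detℕ n M″   ≈⟨ detℕ-sweepRight n t L L<n swept″ unchanged″ ⟩
    detℕ n M    ∎
    where
    L<n = ℕ.<-trans (ℕ.n<1+n L) sL<n
    M″ : Matrix
    M″ = setColumn M' L (λ r → M r L)
    M″-≡ : ∀ r → M″ r L ≡ M r L
    M″-≡ = setColumn-≡ M' L (λ r → M r L)
    M″-≢ : ∀ r {k} → k ≢ L → M″ r k ≡ M' r k
    M″-≢ = setColumn-≢ M' L (λ r → M r L)
    swept″ : ∀ r k → r < n → k < L → M″ r k ≈ M r k + t k * M r (suc k)
    swept″ r k r<n k<L = trans (reflexive (M″-≢ r (ℕ.<⇒≢ k<L))) (swept r k r<n (ℕ.m<n⇒m<1+n k<L))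
    unchanged″ : ∀ r k → r < n → L ≤ k → k < n → M″ r k ≈ M r k
    unchanged″ r k r<n L≤k k<n with ℕ.m≤n⇒m<n∨m≡n L≤k
    ... | inj₁ L<k = trans (reflexive (M″-≢ r (ℕ.<⇒≢ L<k ∘ ≡.sym))) (unchanged r k r<n L<k k<n)
    ... | inj₂ ≡.refl = reflexive (M″-≡ r)

  -- Undo the operation on the first swept column suc l, whose partner column l is untouched.
  detℕ-sweepLeft : ∀ n (t : ℕ → A) {M M' : Matrix} l → suc l ≤ n →
    (∀ r k → r < n → k ≤ l → M' r k ≈ M r k) →
    (∀ r k → r < n → l ≤ k → suc k < n → M' r (suc k) ≈ M r (suc k) + t k * M r k) →
    detℕ n M' ≈ detℕ n M
  detℕ-sweepLeft n t l sl≤n = sweep (n ∸ suc l) l (ℕ.m∸n+n≡m sl≤n)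
    where
    sweep : ∀ d l {M M' : Matrix} → d ℕ.+ suc l ≡ n →
      (∀ r k → r < n → k ≤ l → M' r k ≈ M r k) →
      (∀ r k → r < n → l ≤ k → suc k < n → M' r (suc k) ≈ M r (suc k) + t k * M r k) →
      detℕ n M' ≈ detℕ n M
    sweep zero l ≡.refl unchanged _ = detℕ-cong n (λ r k r<n k<n → unchanged r k r<n (ℕ.≤-pred k<n))
    sweep (suc d) l {M} {M'} ≡.refl unchanged swept = begin
      detℕ n M'   ≈⟨ detℕ-addAdjacentColumn n (suc l) l (t l) sl<n (ℕ.<-trans (ℕ.n<1+n l) sl<n) (inj₂ ≡.refl)
                       (λ r k _ _ k≢sl → reflexive (≡.sym (M″-≢ r k≢sl)))
                       (λ r r<n → trans (swept r l r<n ℕ.≤-refl sl<n)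
                          (+-cong (reflexive (≡.sym (M″-≡ r)))
                                  (*-congˡ (trans (sym (unchanged r l r<n ℕ.≤-refl))
                                                  (reflexive (≡.sym (M″-≢ r (ℕ.1+n≢n ∘ ≡.sym)))))))) ⟩
      detℕ n M″   ≈⟨ sweep d (suc l) (ℕ.+-suc d (suc l)) unchanged″ swept″ ⟩
      detℕ n M    ∎
      where
      sl<n : suc l < n
      sl<n = ℕ.m<n+m (suc l) (s≤s z≤n)
      M″ : Matrix
      M″ = setColumn M' (suc l) (λ r → M r (suc l))
      M″-≡ : ∀ r → M″ r (suc l) ≡ M r (suc l)
      M″-≡ = setColumn-≡ M' (suc l) (λ r → M r (suc l))
      M″-≢ : ∀ r {k} → k ≢ suc l → M″ r k ≡ M' r k
      M″-≢ = setColumn-≢ M' (suc l) (λ r → M r (suc l))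
      unchanged″ : ∀ r k → r < n → k ≤ suc l → M″ r k ≈ M r k
      unchanged″ r k r<n k≤sl with ℕ.m≤n⇒m<n∨m≡n k≤sl
      ... | inj₁ k<sl = trans (reflexive (M″-≢ r (ℕ.<⇒≢ k<sl))) (unchanged r k r<n (ℕ.≤-pred k<sl))
      ... | inj₂ ≡.refl = reflexive (M″-≡ r)
      swept″ : ∀ r k → r < n → suc l ≤ k → suc k < n → M″ r (suc k) ≈ M r (suc k) + t k * M r k
      swept″ r k r<n sl≤k sk<n = trans (reflexive (M″-≢ r (ℕ.<⇒≢ (s≤s sl≤k) ∘ ≡.sym)))
                                        (swept r k r<n (ℕ.<⇒≤ sl≤k) sk<n)

  vandermonde-cong : ∀ n {x x' : Fin n → A} → (∀ i → x i ≈ x' i) → vandermonde R n x ≈ vandermonde R n x'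
  vandermonde-cong zero _ = refl
  vandermonde-cong (suc n) x≈x' =
    *-cong (prodFin-cong (λ j → +-cong (x≈x' zero) (-‿cong (x≈x' (suc j))))) (vandermonde-cong n (x≈x' ∘ suc))

  vandermondeRow : ℕ → (ℕ → A) → ℕ → A
  vandermondeRow n y k = prodℕ (n ∸ suc k) (λ j → y k - y (suc (k ℕ.+ j)))

  vandermonde-rows : ∀ n (y : ℕ → A) → vandermonde R n (y ∘ toℕ) ≈ prodℕ n (vandermondeRow n y)
  vandermonde-rows zero y = refl
  vandermonde-rows (suc n) y = *-congˡ (vandermonde-rows n (y ∘ suc))

  -- After s steps, column k of the matrix has been raised to level s ⊓ (n ∸ suc k) of the
  -- divided-difference tableau F; at step s the live columns, whose level still grows, are k < n ∸ suc s.
  module VandermondeExtraction (n : ℕ) (y : ℕ → A) (F : ℕ → ℕ → ℕ → A)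
    (dividedDifference : ∀ r k m → (y k - y (suc (k ℕ.+ m))) * F r k (suc m) ≈ F r k m - F r (suc k) m) where

    level : ℕ → ℕ → ℕ
    level s k = s ℕ.⊓ (n ∸ suc k)

    stage : ℕ → Matrix
    stage s r k = F r k (level s k)

    difference : ℕ → ℕ → A
    difference k j = y k - y (suc (k ℕ.+ j))

    partialRow : ℕ → ℕ → A
    partialRow s k = prodℕ (level s k) (difference k)

    factor : ℕ → ℕ → A
    factor s k with k ℕ.<? n ∸ suc s
    ... | yes _ = y k - y (suc (k ℕ.+ s))
    ... | no _ = 1#

    module Live s k (live : k < n ∸ suc s) where
      s<room : s < n ∸ suc k
      s<room = m<o∸1+n⇒n<o∸1+m {k} {s} {n} live
      level-s : level s k ≡ s
      level-s = ℕ.m≤n⇒m⊓n≡m (ℕ.<⇒≤ s<room)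
      level-suc-s : level (suc s) k ≡ suc s
      level-suc-s = ℕ.m≤n⇒m⊓n≡m s<room
      level-s-suc : level s (suc k) ≡ s
      level-s-suc = ℕ.m≤n⇒m⊓n≡m (≡.subst (s ≤_) (ℕ.pred[m∸n]≡m∸[1+n] n (suc k)) (ℕ.<⇒≤pred s<room))
      factor≡ : factor s k ≡ y k - y (suc (k ℕ.+ s))
      factor≡ with k ℕ.<? n ∸ suc s
      ... | yes _ = ≡.refl
      ... | no dead = contradiction live dead

    module Dead s k (dead : n ∸ suc s ≤ k) where
      room≤s : n ∸ suc k ≤ s
      room≤s = ℕ.≮⇒≥ (λ s<room → ℕ.<⇒≱ (m<o∸1+n⇒n<o∸1+m {s} {k} {n} s<room) dead)
      level-suc-s : level (suc s) k ≡ level s k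
      level-suc-s = ≡.trans (ℕ.m≥n⇒m⊓n≡n (ℕ.m≤n⇒m≤1+n room≤s)) (≡.sym (ℕ.m≥n⇒m⊓n≡n room≤s))
      factor≡ : factor s k ≡ 1#
      factor≡ with k ℕ.<? n ∸ suc s
      ... | yes live = contradiction live (ℕ.≤⇒≯ dead)
      ... | no _ = ≡.refl

    partialRow-suc : ∀ s k → partialRow (suc s) k ≈ partialRow s k * factor s k
    partialRow-suc s k with ℕ.<-≤-connex k (n ∸ suc s)
    ... | inj₁ live = begin
      partialRow (suc s) k
        ≡⟨ ≡.cong (λ m → prodℕ m (difference k)) (Live.level-suc-s s k live) ⟩
      prodℕ (suc s) (difference k)
        ≈⟨ prodℕ-snoc s (difference k) ⟩
      prodℕ s (difference k) * difference k s
        ≡⟨ ≡.cong₂ (λ m x → prodℕ m (difference k) * x) (Live.level-s s k live) (Live.factor≡ s k live) ⟨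
      partialRow s k * factor s k ∎
    ... | inj₂ dead = begin
      partialRow (suc s) k   ≡⟨ ≡.cong (λ m → prodℕ m (difference k)) (Dead.level-suc-s s k dead) ⟩
      partialRow s k         ≈⟨ *-identityʳ _ ⟨
      partialRow s k * 1#    ≡⟨ ≡.cong (partialRow s k *_) (Dead.factor≡ s k dead) ⟨
      partialRow s k * factor s k ∎

    step : ∀ s → suc s < n → detℕ n (stage s) ≈ prodℕ n (factor s) * detℕ n (stage (suc s))
    step s ss<n = begin
      detℕ n (stage s)                                  ≈⟨ detℕ-sweepRight n (λ _ → - 1#) (n ∸ suc s) L<n swept unchanged ⟨
      detℕ n (λ r k → factor s k * stage (suc s) r k)   ≈⟨ detℕ-scaleColumns n (factor s) (stage (suc s)) ⟩
      prodℕ n (factor s) * detℕ n (stage (suc s))       ∎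
      where
      L<n : n ∸ suc s < n
      L<n = ℕ.∸-monoʳ-< (s≤s z≤n) (ℕ.<⇒≤ ss<n)
      swept : ∀ r k → r < n → k < n ∸ suc s → factor s k * stage (suc s) r k ≈ stage s r k + - 1# * stage s r (suc k)
      swept r k _ live = begin
        factor s k * F r k (level (suc s) k)
          ≡⟨ ≡.cong₂ (λ x m → x * F r k m) (Live.factor≡ s k live) (Live.level-suc-s s k live) ⟩
        (y k - y (suc (k ℕ.+ s))) * F r k (suc s)
          ≈⟨ dividedDifference r k s ⟩
        F r k s - F r (suc k) s
          ≈⟨ +-congˡ (-1*x≈-x _) ⟨
        F r k s + - 1# * F r (suc k) s
          ≡⟨ ≡.cong₂ (λ m m′ → F r k m + - 1# * F r (suc k) m′) (Live.level-s s k live) (Live.level-s-suc s k live) ⟨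
        stage s r k + - 1# * stage s r (suc k) ∎
      unchanged : ∀ r k → r < n → n ∸ suc s ≤ k → k < n → factor s k * stage (suc s) r k ≈ stage s r k
      unchanged r k _ dead _ = begin
        factor s k * F r k (level (suc s) k)
          ≡⟨ ≡.cong₂ (λ x m → x * F r k m) (Dead.factor≡ s k dead) (Dead.level-suc-s s k dead) ⟩
        1# * stage s r k
          ≈⟨ *-identityˡ _ ⟩
        stage s r k ∎

    accumulate : ∀ s → s < n → detℕ n (stage 0) ≈ prodℕ n (partialRow s) * detℕ n (stage s)
    accumulate zero _ = sym (trans (*-congʳ (prodℕ-one n)) (*-identityˡ _))
    accumulate (suc s) ss<n = begin
      detℕ n (stage 0)
        ≈⟨ accumulate s (ℕ.<-trans (ℕ.n<1+n s) ss<n) ⟩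
      prodℕ n (partialRow s) * detℕ n (stage s)
        ≈⟨ *-congˡ (step s ss<n) ⟩
      prodℕ n (partialRow s) * (prodℕ n (factor s) * detℕ n (stage (suc s)))
        ≈⟨ *-assoc _ _ _ ⟨
      (prodℕ n (partialRow s) * prodℕ n (factor s)) * detℕ n (stage (suc s))
        ≈⟨ *-congʳ (prodℕ-mul n (partialRow s) (factor s)) ⟩
      prodℕ n (λ k → partialRow s k * factor s k) * detℕ n (stage (suc s))
        ≈⟨ *-congʳ (prodℕ-cong n (λ k _ → partialRow-suc s k)) ⟨
      prodℕ n (partialRow (suc s)) * detℕ n (stage (suc s)) ∎

  detℕ-extractVandermonde : ∀ n (y : ℕ → A) (F : ℕ → ℕ → ℕ → A) →
    (∀ r k m → (y k - y (suc (k ℕ.+ m))) * F r k (suc m) ≈ F r k m - F r (suc k) m) →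
    detℕ n (λ r k → F r k 0) ≈ vandermonde R n (y ∘ toℕ) * detℕ n (λ r k → F r k (n ∸ suc k))
  detℕ-extractVandermonde zero y F _ = sym (*-identityˡ 1#)
  detℕ-extractVandermonde n@(suc n-1) y F dividedDifference = begin
    detℕ n (stage 0)
      ≈⟨ accumulate n-1 (ℕ.n<1+n n-1) ⟩
    prodℕ n (partialRow n-1) * detℕ n (stage n-1)
      ≈⟨ *-cong (prodℕ-cong n (λ k _ → reflexive (≡.cong (λ m → prodℕ m (difference k)) (final k))))
                (detℕ-cong n (λ r k _ _ → reflexive (≡.cong (F r k) (final k)))) ⟩
    prodℕ n (vandermondeRow n y) * detℕ n (λ r k → F r k (n ∸ suc k))
      ≈⟨ *-congʳ (vandermonde-rows n y) ⟨
    vandermonde R n (y ∘ toℕ) * detℕ n (λ r k → F r k (n ∸ suc k)) ∎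
    where
    open VandermondeExtraction n y F dividedDifference
    final : ∀ k → level n-1 k ≡ n ∸ suc k
    final k = ℕ.m≥n⇒m⊓n≡n (ℕ.∸-monoʳ-≤ {1} {suc k} n (s≤s z≤n))

  -- After s steps column k has been shifted s ⊓ k times.
  detℕ-shiftColumns : ∀ n (P : ℕ → ℕ → ℕ → A) (t : ℕ → ℕ → A) →
    (∀ r k s → s ≤ k → suc k < n → P r (suc k) (suc s) ≈ P r (suc k) s + t k s * P r k s) →
    detℕ n (λ r k → P r k k) ≈ detℕ n (λ r k → P r k 0)
  detℕ-shiftColumns zero P t _ = refl
  detℕ-shiftColumns n@(suc n-1) P t shift = begin
    detℕ n (λ r k → P r k k)
      ≈⟨ detℕ-cong n (λ r k _ k<n → reflexive (≡.cong (P r k) (≡.sym (ℕ.m≥n⇒m⊓n≡n (ℕ.≤-pred k<n))))) ⟩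
    detℕ n (S n-1)
      ≈⟨ iterate n-1 (ℕ.n<1+n n-1) ⟩
    detℕ n (λ r k → P r k 0) ∎
    where
    S : ℕ → Matrix
    S s r k = P r k (s ℕ.⊓ k)

    step : ∀ s → suc s < n → detℕ n (S (suc s)) ≈ detℕ n (S s)
    step s ss<n = detℕ-sweepLeft n (λ k → t k s) s (ℕ.<⇒≤ ss<n) unchanged swept
      where
      unchanged : ∀ r k → r < n → k ≤ s → S (suc s) r k ≈ S s r k
      unchanged r k _ k≤s = reflexive (≡.cong (P r k)
        (≡.trans (ℕ.m≥n⇒m⊓n≡n (ℕ.m≤n⇒m≤1+n k≤s)) (≡.sym (ℕ.m≥n⇒m⊓n≡n k≤s))))
      swept : ∀ r k → r < n → s ≤ k → suc k < n → S (suc s) r (suc k) ≈ S s r (suc k) + t k s * S s r k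
      swept r k _ s≤k sk<n = begin
        P r (suc k) (suc (s ℕ.⊓ k))
          ≡⟨ ≡.cong (P r (suc k) ∘ suc) (ℕ.m≤n⇒m⊓n≡m s≤k) ⟩
        P r (suc k) (suc s)
          ≈⟨ shift r k s s≤k sk<n ⟩
        P r (suc k) s + t k s * P r k s
          ≡⟨ ≡.cong₂ (λ m m′ → P r (suc k) m + t k s * P r k m′)
                     (ℕ.m≤n⇒m⊓n≡m (ℕ.m≤n⇒m≤1+n s≤k)) (ℕ.m≤n⇒m⊓n≡m s≤k) ⟨
        P r (suc k) (s ℕ.⊓ suc k) + t k s * P r k (s ℕ.⊓ k) ∎

    iterate : ∀ s → s < n → detℕ n (S s) ≈ detℕ n (S 0)
    iterate zero _ = refl
    iterate (suc s) ss<n = trans (step s ss<n) (iterate s (ℕ.<-trans (ℕ.n<1+n s) ss<n))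

module CompleteHomogeneous {c ℓ} (R : CommutativeRing c ℓ) where
  open CommutativeRing R renaming (Carrier to A) hiding (zero)
  open import Relation.Binary.Reasoning.Setoid setoid
  open IntegerCoefficientRingSolver R using (solve; _:=_; _:+_; _:*_; _:-_; con)

  segment : (ℕ → A) → ℕ → ℕ → Combo R
  segment y a zero = []
  segment y a (suc l) = (true , y a) ∷ segment y (suc a) l

  segment-snoc : ∀ y a l → segment y a (suc l) ≡ segment y a l ++ [ true , y (a ℕ.+ l) ]
  segment-snoc y a zero = ≡.cong (λ b → [ true , y b ]) (≡.sym (ℕ.+-identityʳ a))
  segment-snoc y a (suc l) = ≡.cong ((true , y a) ∷_)
    (≡.trans (segment-snoc y (suc a) l) (≡.cong (λ b → segment y (suc a) l ++ [ true , y b ]) (≡.sym (ℕ.+-suc a l))))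

  segment-shift : ∀ y a l → segment y (suc a) l ≡ segment (y ∘ suc) a l
  segment-shift y a zero = ≡.refl
  segment-shift y a (suc l) = ≡.cong ((true , y (suc a)) ∷_) (segment-shift y (suc a) l)

  Xn-segment : ∀ {n} (x : Fin n → A) → Xn R x ≡ segment (extend 0# x) 0 n
  Xn-segment {zero} x = ≡.refl
  Xn-segment {suc n} x = ≡.cong ((true , x zero) ∷_)
    (≡.trans (Xn-segment (x ∘ suc)) (≡.sym (segment-shift (extend 0# x) 0 n)))

  hN-∷-cong : ∀ (p : Bool × A) {Z Z' : Combo R} → (∀ m → hN R Z m ≈ hN R Z' m) →
    ∀ m → hN R (p ∷ Z) m ≈ hN R (p ∷ Z') m
  hN-∷-cong (true , u) Z≈Z' zero = Z≈Z' zero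
  hN-∷-cong (true , u) Z≈Z' (suc m) = +-cong (Z≈Z' (suc m)) (*-congˡ (hN-∷-cong (true , u) Z≈Z' m))
  hN-∷-cong (false , u) Z≈Z' zero = Z≈Z' zero
  hN-∷-cong (false , u) Z≈Z' (suc m) = +-cong (Z≈Z' (suc m)) (-‿cong (*-congˡ (Z≈Z' m)))

  hN-recurrence₂ : ∀ u v (Z : Combo R) m →
    hN R ((true , u) ∷ (true , v) ∷ Z) (suc m) ≈ hN R ((true , u) ∷ Z) (suc m) + v * hN R ((true , u) ∷ (true , v) ∷ Z) m
  hN-recurrence₂ u v Z zero =
    solve 4 (λ z₁ v z₀ u → (z₁ :+ v :* z₀) :+ u :* z₀ := (z₁ :+ u :* z₀) :+ v :* z₀) refl (hN R Z 1) v (hN R Z 0) u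
  hN-recurrence₂ u v Z (suc m) = begin
    (hN R Z (suc (suc m)) + v * hN R (v⁺ ∷ Z) (suc m)) + u * hN R (u⁺ ∷ v⁺ ∷ Z) (suc m)
      ≈⟨ +-congˡ (*-congˡ (hN-recurrence₂ u v Z m)) ⟩
    (hN R Z (suc (suc m)) + v * hN R (v⁺ ∷ Z) (suc m)) + u * (hN R (u⁺ ∷ Z) (suc m) + v * hN R (u⁺ ∷ v⁺ ∷ Z) m)
      ≈⟨ solve 6 (λ z v a u b f → (z :+ v :* a) :+ u :* (b :+ v :* f) := (z :+ u :* b) :+ v :* (a :+ u :* f)) refl
           (hN R Z (suc (suc m))) v (hN R (v⁺ ∷ Z) (suc m)) u (hN R (u⁺ ∷ Z) (suc m)) (hN R (u⁺ ∷ v⁺ ∷ Z) m) ⟩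
    (hN R Z (suc (suc m)) + u * hN R (u⁺ ∷ Z) (suc m)) + v * (hN R (v⁺ ∷ Z) (suc m) + u * hN R (u⁺ ∷ v⁺ ∷ Z) m) ∎
    where
    u⁺ v⁺ : Bool × A
    u⁺ = true , u
    v⁺ = true , v

  hN-swap⁺⁻ : ∀ u v (Z : Combo R) m → hN R ((true , u) ∷ (false , v) ∷ Z) m ≈ hN R ((false , v) ∷ (true , u) ∷ Z) m
  hN-swap⁺⁻ u v Z zero = refl
  hN-swap⁺⁻ u v Z (suc zero) =
    solve 4 (λ z₁ v z₀ u → (z₁ :- v :* z₀) :+ u :* z₀ := (z₁ :+ u :* z₀) :- v :* z₀) refl (hN R Z 1) v (hN R Z 0) u
  hN-swap⁺⁻ u v Z (suc (suc m)) = begin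
    (hN R Z (suc (suc m)) - v * hN R Z (suc m)) + u * hN R ((true , u) ∷ (false , v) ∷ Z) (suc m)
      ≈⟨ +-congˡ (*-congˡ (hN-swap⁺⁻ u v Z (suc m))) ⟩
    (hN R Z (suc (suc m)) - v * hN R Z (suc m)) + u * ((hN R Z (suc m) + u * b) - v * b)
      ≈⟨ solve 5 (λ z₂ v z₁ u b → (z₂ :- v :* z₁) :+ u :* ((z₁ :+ u :* b) :- v :* b)
                                   := (z₂ :+ u :* (z₁ :+ u :* b)) :- v :* (z₁ :+ u :* b)) refl
           (hN R Z (suc (suc m))) v (hN R Z (suc m)) u b ⟩
    (hN R Z (suc (suc m)) + u * (hN R Z (suc m) + u * b)) - v * (hN R Z (suc m) + u * b) ∎
    where
    b = hN R ((true , u) ∷ Z) m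

  hN-swap : ∀ (p q : Bool × A) (Z : Combo R) m → hN R (p ∷ q ∷ Z) m ≈ hN R (q ∷ p ∷ Z) m
  hN-swap (true , u) (true , v) Z zero = refl
  hN-swap (true , u) (true , v) Z (suc m) =
    trans (hN-recurrence₂ u v Z m) (+-congˡ (*-congˡ (hN-swap (true , u) (true , v) Z m)))
  hN-swap (true , u) (false , v) Z m = hN-swap⁺⁻ u v Z m
  hN-swap (false , u) (true , v) Z m = sym (hN-swap⁺⁻ v u Z m)
  hN-swap (false , u) (false , v) Z zero = refl
  hN-swap (false , u) (false , v) Z (suc zero) =
    solve 4 (λ z₁ v z₀ u → (z₁ :- v :* z₀) :- u :* z₀ := (z₁ :- u :* z₀) :- v :* z₀) refl (hN R Z 1) v (hN R Z 0) u
  hN-swap (false , u) (false , v) Z (suc (suc m)) =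
    solve 5 (λ z₂ v z₁ u z₀ → (z₂ :- v :* z₁) :- u :* (z₁ :- v :* z₀)
                             := (z₂ :- u :* z₁) :- v :* (z₁ :- u :* z₀)) refl
      (hN R Z (suc (suc m))) v (hN R Z (suc m)) u (hN R Z m)

  hN-↭ : ∀ {Z Z' : Combo R} → Z ↭ Z' → ∀ m → hN R Z m ≈ hN R Z' m
  hN-↭ ↭.refl m = refl
  hN-↭ (↭.prep p Z↭Z') = hN-∷-cong p (hN-↭ Z↭Z')
  hN-↭ (↭.swap p q Z↭Z') m = trans (hN-swap p q _ m) (hN-∷-cong q (hN-∷-cong p (hN-↭ Z↭Z')) m)
  hN-↭ (↭.trans Z↭Z′ Z′↭Z″) m = trans (hN-↭ Z↭Z′ m) (hN-↭ Z′↭Z″ m)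

  h-↭ : ∀ {Z Z' : Combo R} → Z ↭ Z' → ∀ k → h R k Z ≈ h R k Z'
  h-↭ Z↭Z' (+ m) = hN-↭ Z↭Z' m
  h-↭ Z↭Z' -[1+ m ] = refl

  h-dividedDifference : ∀ u v (Z : Combo R) k →
    h R (ℤ.suc k) ((true , u) ∷ Z) - h R (ℤ.suc k) ((true , v) ∷ Z) ≈ (u - v) * h R k ((true , u) ∷ (true , v) ∷ Z)
  h-dividedDifference u v Z (+ m) = begin
    hu - hv                           ≈⟨ solve 4 (λ a b v f → a :- b := ((a :+ v :* f) :- v :* f) :- b) refl hu hv v huv ⟩
    ((hu + v * huv) - v * huv) - hv   ≈⟨ +-congʳ (+-congʳ (sym (hN-recurrence₂ u v Z m))) ⟩
    ((hv + u * huv) - v * huv) - hv   ≈⟨ solve 4 (λ a u f v → ((a :+ u :* f) :- v :* f) :- a := (u :- v) :* f) refl hv u huv v ⟩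
    (u - v) * huv                     ∎
    where
    hu = hN R ((true , u) ∷ Z) (suc m)
    hv = hN R ((true , v) ∷ Z) (suc m)
    huv = hN R ((true , u) ∷ (true , v) ∷ Z) m
  h-dividedDifference u v Z -[1+ zero ] =
    solve 3 (λ z u v → z :- z := (u :- v) :* con (+ 0)) refl (hN R Z 0) u v
  h-dividedDifference u v Z -[1+ suc m ] =
    solve 2 (λ u v → con (+ 0) :- con (+ 0) := (u :- v) :* con (+ 0)) refl u v

  h-removeNegative : ∀ u β (Y : Combo R) k →
    h R (ℤ.suc k) ((false , β) ∷ (true , u) ∷ Y) ≈ h R (ℤ.suc k) Y + (u - β) * h R k ((true , u) ∷ Y)
  h-removeNegative u β Y (+ m) =
    solve 4 (λ y u b β → (y :+ u :* b) :- β :* b := y :+ (u :- β) :* b) refl (hN R Y (suc m)) u (hN R ((true , u) ∷ Y) m) β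
  h-removeNegative u β Y -[1+ zero ] =
    solve 3 (λ y u β → y := y :+ (u :- β) :* con (+ 0)) refl (hN R Y 0) u β
  h-removeNegative u β Y -[1+ suc m ] =
    solve 2 (λ u β → con (+ 0) := con (+ 0) :+ (u :- β) :* con (+ 0)) refl u β


module GNumerator {c ℓ} (R : CommutativeRing c ℓ) (n : ℕ) (lam : Fin n → ℕ)
                  (x : Fin n → CommutativeRing.Carrier R) (α β : ℕ → CommutativeRing.Carrier R) where
  open CommutativeRing R renaming (Carrier to A) hiding (zero)
  open import Relation.Binary.Reasoning.Setoid setoid
  open Determinant R
  open CompleteHomogeneous R

  y : ℕ → A
  y = extend 0# x

  μ : ℕ → ℕ
  μ = extend 0 lam

  -- Row r (counted from 0) has entries h_{λ_r - (r+1) + k}[S - A_{λ_r - 1} + B_r].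
  offset : ℕ → ℤ
  offset r = + μ r ℤ.- + suc r

  rowTail : ℕ → Combo R
  rowTail r = negA R α (μ r ∸ 1) ++ sumA R β r

  entry : ℕ → Combo R → ℤ → A
  entry r S k = h R (offset r ℤ.+ k) (S ++ rowTail r)

  -- divided r k 0 are the entries of the numerator and shifted r k k those of the right-hand side.
  divided : ℕ → ℕ → ℕ → A
  divided r k m = entry r (segment y k (suc m)) (+ n ℤ.- + m)

  shifted : ℕ → ℕ → ℕ → A
  shifted r k q = entry r (segment y (k ∸ q) (n ∸ (k ∸ q)) ++ negA R β q) (+ suc k)

  divided-step : ∀ r k m → (y k - y (suc (k ℕ.+ m))) * divided r k (suc m) ≈ divided r k m - divided r (suc k) m
  divided-step r k m = begin
    (u - v) * h R i (u⁺ ∷ (segment y (suc k) (suc m) ++ rowTail r))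
      ≈⟨ *-congˡ (h-↭ (↭.prep u⁺ last↭first) i) ⟩
    (u - v) * h R i (u⁺ ∷ v⁺ ∷ Z)
      ≈⟨ h-dividedDifference u v Z i ⟨
    h R (ℤ.suc i) (u⁺ ∷ Z) - h R (ℤ.suc i) (v⁺ ∷ Z)
      ≈⟨ +-cong (reflexive (≡.cong (λ j → h R j (u⁺ ∷ Z)) index))
                (-‿cong (trans (h-↭ last↭first (offset r ℤ.+ (+ n ℤ.- + m)))
                               (reflexive (≡.cong (λ j → h R j (v⁺ ∷ Z)) index)))) ⟨
    divided r k m - divided r (suc k) m ∎
    where
    u = y k
    v = y (suc (k ℕ.+ m))
    u⁺ v⁺ : Bool × A
    u⁺ = true , u
    v⁺ = true , v
    Z = segment y (suc k) m ++ rowTail r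
    i = offset r ℤ.+ (+ n ℤ.- + suc m)
    index : offset r ℤ.+ (+ n ℤ.- + m) ≡ ℤ.suc i
    index = e+[a-b]≡1+[e+[a-[1+b]]] (offset r) (+ n) (+ m)
    last↭first : segment y (suc k) (suc m) ++ rowTail r ↭ v⁺ ∷ Z
    last↭first = ↭.↭-trans (↭-reflexive (≡.cong (_++ rowTail r) (segment-snoc y (suc k) m)))
                           (++-snoc↭∷ (segment y (suc k) m) v⁺ (rowTail r))

  shifted-step : ∀ r k s → s ≤ k → suc k < n →
    shifted r (suc k) (suc s) ≈ shifted r (suc k) s + (y (k ∸ s) - β (suc s)) * shifted r k s
  shifted-step r k s s≤k sk<n = begin
    h R (offset r ℤ.+ + suc (suc k)) ((segment y a (n ∸ a) ++ (β⁻ ∷ B)) ++ rowTail r)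
      ≡⟨ ≡.cong₂ (λ j l → h R j ((segment y a l ++ (β⁻ ∷ B)) ++ rowTail r)) index room ⟩
    h R (ℤ.suc i) (((y⁺ ∷ S) ++ (β⁻ ∷ B)) ++ rowTail r)
      ≈⟨ h-↭ (∷-++-∷↭ y⁺ S β⁻ B (rowTail r)) (ℤ.suc i) ⟩
    h R (ℤ.suc i) (β⁻ ∷ y⁺ ∷ Y)
      ≈⟨ h-removeNegative (y a) (β (suc s)) Y i ⟩
    h R (ℤ.suc i) Y + (y a - β (suc s)) * h R i (y⁺ ∷ Y)
      ≈⟨ +-cong (reflexive (≡.cong₂ (λ j a′ → h R j ((segment y a′ (n ∸ a′) ++ B) ++ rowTail r))
                                    index (ℕ.+-∸-assoc 1 s≤k)))
                (*-congˡ (reflexive (≡.cong (λ l → h R i ((segment y a l ++ B) ++ rowTail r)) room))) ⟨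
    shifted r (suc k) s + (y a - β (suc s)) * shifted r k s ∎
    where
    a = k ∸ s
    room : n ∸ a ≡ suc (n ∸ suc a)
    room = ∸-suc-< (ℕ.≤-<-trans (ℕ.m∸n≤m k s) (ℕ.<-trans (ℕ.n<1+n k) sk<n))
    y⁺ β⁻ : Bool × A
    y⁺ = true , y a
    β⁻ = false , β (suc s)
    S = segment y (suc a) (n ∸ suc a)
    B = negA R β s
    Y = (S ++ B) ++ rowTail r
    i = offset r ℤ.+ + suc k
    index : offset r ℤ.+ + suc (suc k) ≡ ℤ.suc i
    index = e+[1+a]≡1+[e+a] (offset r) (+ suc k)

  lhs-entry : ∀ (i j : Fin n) →
    h R (+ (lam i ℕ.+ (n ∸ idx R i))) ((true , x j) ∷ (negA R α (lam i ∸ 1) ++ sumA R β (idx R i ∸ 1)))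
      ≈ divided (toℕ i) (toℕ j) 0
  lhs-entry i j = begin
    h R (+ (lam i ℕ.+ (n ∸ suc (toℕ i)))) (entries (lam i) (x j))
      ≡⟨ ≡.cong (λ k → h R k (entries (lam i) (x j))) index ⟩
    h R ((+ lam i ℤ.- + suc (toℕ i)) ℤ.+ (+ n ℤ.- + 0)) (entries (lam i) (x j))
      ≡⟨ ≡.cong₂ (λ L u → h R ((+ L ℤ.- + suc (toℕ i)) ℤ.+ (+ n ℤ.- + 0)) (entries L u))
                 (extend-toℕ 0 lam i) (extend-toℕ 0# x j) ⟨
    divided (toℕ i) (toℕ j) 0 ∎
    where
    entries : ℕ → A → Combo R
    entries L u = (true , u) ∷ (negA R α (L ∸ 1) ++ sumA R β (toℕ i))
    index : + (lam i ℕ.+ (n ∸ suc (toℕ i))) ≡ (+ lam i ℤ.- + suc (toℕ i)) ℤ.+ (+ n ℤ.- + 0)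
    index = ≡.trans (a+b≡[a-c]+[[b+c]-0] (+ lam i) (+ (n ∸ suc (toℕ i))) (+ suc (toℕ i)))
                    (≡.cong (λ m → (+ lam i ℤ.- + suc (toℕ i)) ℤ.+ (+ m ℤ.- + 0)) (ℕ.m∸n+n≡m (Fin.toℕ<n i)))

  divided≡shifted : ∀ r k → k < n → divided r k (n ∸ suc k) ≡ shifted r k 0
  divided≡shifted r k k<n = ≡.cong₂ (λ j S → h R (offset r ℤ.+ j) (S ++ rowTail r)) index segments
    where
    index : + n ℤ.- + (n ∸ suc k) ≡ + suc k
    index = ≡.trans (≡.cong (λ m → + m ℤ.- + (n ∸ suc k)) (≡.sym (ℕ.m∸n+n≡m k<n)))
                    ([a+b]-a≡b (+ (n ∸ suc k)) (+ suc k))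
    segments : segment y k (suc (n ∸ suc k)) ≡ segment y k (n ∸ k) ++ []
    segments = ≡.trans (≡.cong (segment y k) (≡.sym (∸-suc-< k<n))) (≡.sym (List.++-identityʳ _))

  shifted-rhs : ∀ (i j : Fin n) → shifted (toℕ i) (toℕ j) (toℕ j) ≈
    h R ((+ lam i ℤ.- + idx R i) ℤ.+ + idx R j)
        (Xn R x ++ (negA R α (lam i ∸ 1) ++ (sumA R β (idx R i ∸ 1) ++ negA R β (idx R j ∸ 1))))
  shifted-rhs i j = begin
    shifted (toℕ i) (toℕ j) (toℕ j)
      ≡⟨ ≡.cong₂ (λ L d → h R ((+ L ℤ.- + suc (toℕ i)) ℤ.+ + suc (toℕ j))
                              ((segment y d (n ∸ d) ++ Bj) ++ (negA R α (L ∸ 1) ++ Bi)))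
                 (extend-toℕ 0 lam i) (ℕ.n∸n≡0 (toℕ j)) ⟩
    h R k ((segment y 0 n ++ Bj) ++ (Aα ++ Bi))
      ≡⟨ ≡.cong (λ X → h R k ((X ++ Bj) ++ (Aα ++ Bi))) (Xn-segment x) ⟨
    h R k ((Xn R x ++ Bj) ++ (Aα ++ Bi))
      ≈⟨ h-↭ (++-rotate↭ (Xn R x) Aα Bi Bj) k ⟩
    h R k (Xn R x ++ (Aα ++ (Bi ++ Bj))) ∎
    where
    k = (+ lam i ℤ.- + suc (toℕ i)) ℤ.+ + suc (toℕ j)
    Aα = negA R α (lam i ∸ 1)
    Bi = sumA R β (toℕ i)
    Bj = negA R β (toℕ j)

  gNumerator≈vandermonde*rhsDet : gNumerator R n lam x α β ≈ vandermonde R n x * rhsDet R n lam x α β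
  gNumerator≈vandermonde*rhsDet = begin
    gNumerator R n lam x α β
      ≈⟨ det-cong n lhs-entry ⟩
    detℕ n (λ r k → divided r k 0)
      ≈⟨ detℕ-extractVandermonde n y divided divided-step ⟩
    vandermonde R n (y ∘ toℕ) * detℕ n (λ r k → divided r k (n ∸ suc k))
      ≈⟨ *-cong (vandermonde-cong n (λ i → reflexive (extend-toℕ 0# x i)))
                (detℕ-cong n (λ r k _ k<n → reflexive (divided≡shifted r k k<n))) ⟩
    vandermonde R n x * detℕ n (λ r k → shifted r k 0)
      ≈⟨ *-congˡ (detℕ-shiftColumns n shifted (λ k s → y (k ∸ s) - β (suc s)) shifted-step) ⟨
    vandermonde R n x * detℕ n (λ r k → shifted r k k)
      ≈⟨ *-congˡ (det-cong n shifted-rhs) ⟩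
    vandermonde R n x * rhsDet R n lam x α β ∎

-- The identity holds for every λ : Fin n → ℕ.
theorem5p1 : ∀ {c ℓ} (R : CommutativeRing c ℓ) (n : ℕ) (lam : Fin n → ℕ) → IsPartition lam →
    (x : Fin n → CommutativeRing.Carrier R) (α β : ℕ → CommutativeRing.Carrier R) →
    CommutativeRing._≈_ R (gNumerator R n lam x α β)
      (CommutativeRing._*_ R (vandermonde R n x) (rhsDet R n lam x α β))
theorem5p1 R n lam _ x α β = GNumerator.gNumerator≈vandermonde*rhsDet R n lam x α β
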